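{- Let $n$, $a$, $q$, $r$ be integers with $n=qa+r$, $a\ge 4$, $q\ge 2$, and either ($a\le q+r+1$ and $0\le r\le a-2$) or ($a\le q+1$ and $r=a-1$). Then for every $(a-1)$-bounded independent broadcast $f$ on $\overrightarrow{C}(n;1,a)$, $$\sigma(f) \le \left\lfloor \frac{a-2}{a-1}\left(n-|V_f^1|\right)\right\rfloor - (a-3)|V_f^1|,$$ where $V_f^1=\{v : f(v)=a-1\}$.
   Context: The oriented circulant graph $\overrightarrow{C}(n;1,a)$ has vertex set $\{v_0,\dots,v_{n-1}\}$ and arcs $v_iv_{i+1}$, $v_iv_{i+a}$, subscripts modulo $n$. $d(u,v)$ is the length of a shortest directed path from $u$ to $v$; $e(v)=\max_u d(v,u)$; $\mathrm{diam}$ is the maximum eccentricity. An independent broadcast is $f:V\to\{0,\dots,\mathrm{diam}\}$ with $f(v)\le e(v)$ for all $v$ and $d(u,v)>f(u)$ for all distinct $u,v$ with $f(u),f(v)>0$; its cost is $\sigma(f)=\sum_v f(v)$. It is $\ell$-bounded if $f(v)\le \ell$ for every $v$. -}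

module Defs where

open import Data.Nat using (ℕ; zero; suc; _+_; _*_; _∸_; _≤_; _<_; _⊔_; NonZero)
open import Data.Nat.DivMod using (_%_; _/_; m%n<n)
open import Data.Fin using (Fin; toℕ; fromℕ<)
open import Data.Fin.Properties using () renaming (_≟_ to _≟F_)
open import Data.Bool using (Bool; true; false; _∨_; _∧_; if_then_else_)
open import Data.List using (List; allFin; map; foldr; filter; length)
open import Data.Bool.ListAction using (any)
open import Data.Nat.ListAction using (sum)
open import Relation.Nullary.Decidable using (⌊_⌋)
open import Data.Nat.Properties using (_≟_)
open import Relation.Binary.PropositionalEquality using (_≡_; _≢_)
open import Data.Product using (_×_)

-- Vertices of C(n;1,a) are Fin n (v_i ↦ i).

nonZeroFin : ∀ {n} → Fin n → NonZero n
nonZeroFin {suc n} _ = record {}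

_⊕_ : ∀ {n} → Fin n → ℕ → Fin n
_⊕_ {n} i k = fromℕ< (m%n<n (toℕ i + k) n {{nonZeroFin i}}) where
  instance
    nz : NonZero n
    nz = nonZeroFin i

arc : ∀ {n} → ℕ → Fin n → Fin n → Bool
arc a w u = ⌊ u ≟F (w ⊕ 1) ⌋ ∨ ⌊ u ≟F (w ⊕ a) ⌋

within : ∀ {n} → ℕ → Fin n → ℕ → Fin n → Bool
within a v zero u = ⌊ u ≟F v ⌋
within {n} a v (suc k) u =
  within a v k u ∨ any (λ w → within a v k w ∧ arc a w u) (allFin n)

minWithin : ∀ {n} → ℕ → Fin n → Fin n → ℕ → ℕ → ℕ
minWithin a v u zero k = k
minWithin a v u (suc fuel) k =
  if within a v k u then k else minWithin a v u fuel (suc k)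

-- d(v,u): shortest directed path length (the graph is strongly connected via
-- the arcs v_i v_{i+1}, so d(v,u) ≤ n-1 and the search with fuel n suffices)
dist : ∀ {n} → ℕ → Fin n → Fin n → ℕ
dist {n} a v u = minWithin a v u n 0

maxList : List ℕ → ℕ
maxList = foldr _⊔_ 0

ecc : ∀ {n} → ℕ → Fin n → ℕ
ecc {n} a v = maxList (map (dist a v) (allFin n))

diam : ℕ → ℕ → ℕ
diam n a = maxList (map (ecc {n} a) (allFin n))

IndependentBroadcast : (n a : ℕ) → (Fin n → ℕ) → Set
IndependentBroadcast n a f =
  (∀ v → f v ≤ diam n a) ×
  (∀ v → f v ≤ ecc a v) ×
  (∀ u v → u ≢ v → 0 < f u → 0 < f v → f u < dist a u v)

Bounded : ∀ {n} → ℕ → (Fin n → ℕ) → Set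
Bounded ℓ f = ∀ v → f v ≤ ℓ

cost : ∀ {n} → (Fin n → ℕ) → ℕ
cost {n} f = sum (map f (allFin n))

countEq : ∀ {n} → ℕ → (Fin n → ℕ) → ℕ
countEq {n} m f = length (filter (λ v → f v ≟ m) (allFin n))

-- floor division x / d (only used with d ≥ 1; value for d = 0 irrelevant)
fdiv : ℕ → ℕ → ℕ
fdiv x zero = 0
fdiv x (suc d) = x / suc d

-- A vertex v_p broadcasting with strength t > 0 forces v_{p+1}, …, v_{p+t} to be silent,
-- since d(v_p, v_{p+j}) ≤ j; if t = a − 1 it even silences v_{p+1}, …, v_{p+2a−2}, since the
-- arc v_p v_{p+a} gives d(v_p, v_{p+j}) ≤ 1 + j − a for j ≥ a.  So the intervals
-- [p, p + zone (f v_p)), with zone t = t + 1 for t < a − 1 and zone (a − 1) = 2a − 1, are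
-- pairwise disjoint on the n-cycle (n ≥ 2a keeps all of this local), and double counting
-- gives ∑ zone ≤ n.  The weight (a − 1) t + ((a − 1)(a − 3) + (a − 2)) [t = a − 1] is at
-- most (a − 2) zone t, with equality at t = a − 1, hence
-- (a − 1) σ(f) + ((a − 1)(a − 3) + (a − 2)) |V¹| ≤ (a − 2) n, which rearranges to the bound.
module Submission where

open import Defs
open import Data.Nat using (ℕ; _+_; _*_; _∸_; _≤_)
open import Data.Fin using (Fin)
open import Data.Integer using (+_; _-_) renaming (_≤_ to _≤ℤ_)
open import Data.Product using (_×_)
open import Data.Sum using (_⊎_)
open import Relation.Binary.PropositionalEquality using (_≡_)

open import Data.Nat using (zero; suc; _<_; _⊓_; z≤n; s≤s; _≤?_)
open import Data.Nat.Properties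
open import Data.Nat.DivMod
open import Data.Nat.ListAction using (sum)
open import Algebra.Properties.CommutativeSemigroup +-commutativeSemigroup using (interchange)
open import Data.Nat.Tactic.RingSolver using (solve-∀)
open import Data.Fin using (toℕ)
import Data.Fin as Fin
open import Data.Fin.Properties using (toℕ-fromℕ<; toℕ-injective; toℕ<n) renaming (_≟_ to _≟F_)
open import Data.List using (List; []; _∷_; map; allFin; tabulate; filter; length)
open import Data.List.Properties using (map-tabulate)
open import Data.List.Membership.Propositional using (lose)
open import Data.List.Membership.Propositional.Properties using (∈-allFin)
open import Data.List.Relation.Unary.Any.Properties using (any⁺)
open import Data.Bool using (T; true; false)
open import Data.Bool.Properties using (T-∨; T-∧)
open import Data.Integer using (+≤+)
open import Data.Integer.Properties using (m-n≡m⊖n; ⊖-≥)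
open import Data.Product using (_,_; proj₂)
open import Data.Sum using (inj₁; inj₂)
open import Function using (_∘_)
open import Function.Bundles using (Equivalence)
open import Relation.Nullary using (Dec; yes; no; ¬_; contradiction)
open import Relation.Nullary.Decidable using (⌊_⌋; fromWitness)
open import Relation.Unary using (Pred; Decidable)
open import Relation.Binary.PropositionalEquality
  using (refl; sym; trans; cong; cong₂; subst; _≢_; module ≡-Reasoning)

private variable m : ℕ

∑ : ℕ → (ℕ → ℕ) → ℕ
∑ zero    h = 0
∑ (suc n) h = h 0 + ∑ n (λ i → h (suc i))

syntax ∑ n (λ i → e) = ∑[ i < n ] e

∑-cong : ∀ n {h h′ : ℕ → ℕ} → (∀ i → h i ≡ h′ i) → ∑ n h ≡ ∑ n h′
∑-cong zero    h≗h′ = refl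
∑-cong (suc n) h≗h′ = cong₂ _+_ (h≗h′ 0) (∑-cong n (h≗h′ ∘ suc))

∑-mono-≤ : ∀ n {h h′ : ℕ → ℕ} → (∀ i → h i ≤ h′ i) → ∑ n h ≤ ∑ n h′
∑-mono-≤ zero    h≤h′ = z≤n
∑-mono-≤ (suc n) h≤h′ = +-mono-≤ (h≤h′ 0) (∑-mono-≤ n (h≤h′ ∘ suc))

∑-distrib-+ : ∀ n (h h′ : ℕ → ℕ) → ∑[ i < n ] (h i + h′ i) ≡ ∑ n h + ∑ n h′
∑-distrib-+ zero    h h′ = refl
∑-distrib-+ (suc n) h h′ = begin
  h 0 + h′ 0 + ∑[ i < n ] (h (suc i) + h′ (suc i))
    ≡⟨ cong (_+_ (h 0 + h′ 0)) (∑-distrib-+ n (h ∘ suc) (h′ ∘ suc)) ⟩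
  h 0 + h′ 0 + (∑ n (h ∘ suc) + ∑ n (h′ ∘ suc))
    ≡⟨ interchange (h 0) (h′ 0) _ _ ⟩
  h 0 + ∑ n (h ∘ suc) + (h′ 0 + ∑ n (h′ ∘ suc)) ∎
  where open ≡-Reasoning

∑-distribˡ-* : ∀ n k (h : ℕ → ℕ) → ∑[ i < n ] (k * h i) ≡ k * ∑ n h
∑-distribˡ-* zero    k h = sym (*-zeroʳ k)
∑-distribˡ-* (suc n) k h =
  trans (cong (_+_ (k * h 0)) (∑-distribˡ-* n k (h ∘ suc))) (sym (*-distribˡ-+ k (h 0) _))

∑-const : ∀ n k → ∑[ i < n ] k ≡ n * k
∑-const zero    k = refl
∑-const (suc n) k = cong (_+_ k) (∑-const n k)

∑-snoc : ∀ n (h : ℕ → ℕ) → ∑ (suc n) h ≡ ∑ n h + h n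
∑-snoc zero    h = +-comm (h 0) 0
∑-snoc (suc n) h = trans (cong (_+_ (h 0)) (∑-snoc n (h ∘ suc))) (sym (+-assoc (h 0) _ _))

∑-comm : ∀ m n (h : ℕ → ℕ → ℕ) → ∑[ i < m ] ∑[ j < n ] h i j ≡ ∑[ j < n ] ∑[ i < m ] h i j
∑-comm zero    n h = sym (trans (∑-const n 0) (*-zeroʳ n))
∑-comm (suc m) n h = begin
  ∑[ j < n ] h 0 j + ∑[ i < m ] ∑[ j < n ] h (suc i) j
    ≡⟨ cong (_+_ (∑[ j < n ] h 0 j)) (∑-comm m n (h ∘ suc)) ⟩
  ∑[ j < n ] h 0 j + ∑[ j < n ] ∑[ i < m ] h (suc i) j
    ≡⟨ sym (∑-distrib-+ n (h 0) (λ j → ∑[ i < m ] h (suc i) j)) ⟩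
  ∑[ j < n ] (h 0 j + ∑[ i < m ] h (suc i) j) ∎
  where open ≡-Reasoning

∑-rotate : ∀ n (h : ℕ → ℕ) → h n ≡ h 0 → ∑[ i < n ] h (suc i) ≡ ∑ n h
∑-rotate n h hn≡h0 = +-cancelʳ-≡ (h 0) _ _ (begin
  ∑[ i < n ] h (suc i) + h 0 ≡⟨ +-comm _ (h 0) ⟩
  ∑ (suc n) h                ≡⟨ ∑-snoc n h ⟩
  ∑ n h + h n                ≡⟨ cong (_+_ (∑ n h)) hn≡h0 ⟩
  ∑ n h + h 0                ∎)
  where open ≡-Reasoning

∑-periodic : ∀ n (h : ℕ → ℕ) → (∀ i → h (i + n) ≡ h i) → ∀ s → ∑[ i < n ] h (i + s) ≡ ∑ n h
∑-periodic n h periodic zero    = ∑-cong n (cong h ∘ +-identityʳ)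
∑-periodic n h periodic (suc s) = begin
  ∑[ i < n ] h (i + suc s) ≡⟨ ∑-cong n (λ i → cong h (+-suc i s)) ⟩
  ∑[ i < n ] h (suc i + s) ≡⟨ ∑-rotate n (λ i → h (i + s)) (trans (cong h (+-comm n s)) (periodic s)) ⟩
  ∑[ i < n ] h (i + s)     ≡⟨ ∑-periodic n h periodic s ⟩
  ∑ n h                    ∎
  where open ≡-Reasoning

𝟙 : {P : Set} → Dec P → ℕ
𝟙 (yes _) = 1
𝟙 (no _)  = 0

∑-𝟙-none : {P : Pred ℕ _} (P? : Decidable P) → ∀ n → (∀ j → j < n → ¬ P j) →
           ∑[ j < n ] 𝟙 (P? j) ≡ 0
∑-𝟙-none P? zero    none = refl
∑-𝟙-none P? (suc n) none with P? 0
... | yes p = contradiction p (none 0 (s≤s z≤n))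
... | no _  = ∑-𝟙-none (P? ∘ suc) n (λ j j<n → none (suc j) (s≤s j<n))

∑-𝟙-≤1 : {P : Pred ℕ _} (P? : Decidable P) → ∀ n → (∀ i j → i < j → j < n → P i → ¬ P j) →
         ∑[ j < n ] 𝟙 (P? j) ≤ 1
∑-𝟙-≤1 P? zero    unique = z≤n
∑-𝟙-≤1 P? (suc n) unique with P? 0
... | yes p = ≤-reflexive (cong suc (∑-𝟙-none (P? ∘ suc) n
                (λ j j<n → unique 0 (suc j) (s≤s z≤n) (s≤s j<n) p)))
... | no _  = ∑-𝟙-≤1 (P? ∘ suc) n (λ i j i<j j<n → unique (suc i) (suc j) (s≤s i<j) (s≤s j<n))

∑-𝟙-∸≤ : ∀ L x → ∑[ j < L ] 𝟙 (L ∸ j ≤? x) ≡ L ⊓ x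
∑-𝟙-∸≤ zero    x = refl
∑-𝟙-∸≤ (suc L) x with suc L ≤? x
... | yes L<x =
  trans (cong suc (trans (∑-𝟙-∸≤ L x) (m≤n⇒m⊓n≡m (<⇒≤ L<x)))) (sym (m≤n⇒m⊓n≡m L<x))
... | no  L≮x =
  trans (∑-𝟙-∸≤ L x) (trans (m≥n⇒m⊓n≡n x≤L) (sym (m≥n⇒m⊓n≡n (m≤n⇒m≤1+n x≤L))))
  where x≤L = ≤-pred (≰⇒> L≮x)

sum-tabulate : ∀ {n} (F : Fin n → ℕ) (h : ℕ → ℕ) → (∀ i → h (toℕ i) ≡ F i) →
               sum (tabulate F) ≡ ∑ n h
sum-tabulate {zero}  F h h≗F = refl
sum-tabulate {suc n} F h h≗F =
  cong₂ _+_ (sym (h≗F Fin.zero)) (sum-tabulate (F ∘ Fin.suc) (h ∘ suc) (h≗F ∘ Fin.suc))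

sum-map-allFin : ∀ {n} (F : Fin n → ℕ) (h : ℕ → ℕ) → (∀ i → h (toℕ i) ≡ F i) →
                 sum (map F (allFin n)) ≡ ∑ n h
sum-map-allFin F h h≗F = trans (cong sum (map-tabulate (λ i → i) F)) (sum-tabulate F h h≗F)

length-filter≡sum-𝟙 : {A : Set} {P : Pred A _} (P? : Decidable P) (xs : List A) →
                      length (filter P? xs) ≡ sum (map (𝟙 ∘ P?) xs)
length-filter≡sum-𝟙 P? []       = refl
length-filter≡sum-𝟙 P? (x ∷ xs) with P? x
... | yes _ = cong suc (length-filter≡sum-𝟙 P? xs)
... | no _  = length-filter≡sum-𝟙 P? xs

-- Double counting: the point i + L − 1 lies in the interval [i + j, i + j + ℓ (i + j)), j < L,
-- iff L − j ≤ ℓ (i + j), and by separation in at most one of them.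
disjoint-intervals⇒∑≤period : ∀ n L (ℓ : ℕ → ℕ) → (∀ i → ℓ (i + n) ≡ ℓ i) → (∀ i → ℓ i ≤ L) →
  (∀ p d → 0 < d → d < L → 0 < ℓ (p + d) → ℓ p ≤ d) → ∑ n ℓ ≤ n
disjoint-intervals⇒∑≤period n L ℓ periodic bounded separated = begin
  ∑ n ℓ
    ≡⟨ ∑-cong n (λ i → sym (trans (∑-𝟙-∸≤ L (ℓ i)) (m≥n⇒m⊓n≡n (bounded i)))) ⟩
  ∑[ i < n ] ∑[ j < L ] covers (ℓ i) j
    ≡⟨ ∑-comm n L _ ⟩
  ∑[ j < L ] ∑[ i < n ] covers (ℓ i) j
    ≡⟨ ∑-cong L (λ j → sym (∑-periodic n _ (λ i → cong (λ x → covers x j) (periodic i)) j)) ⟩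
  ∑[ j < L ] ∑[ i < n ] covers (ℓ (i + j)) j
    ≡⟨ ∑-comm L n _ ⟩
  ∑[ i < n ] ∑[ j < L ] covers (ℓ (i + j)) j
    ≤⟨ ∑-mono-≤ n (λ i → ∑-𝟙-≤1 (λ j → L ∸ j ≤? ℓ (i + j)) L (at-most-one-cover i)) ⟩
  ∑[ i < n ] 1
    ≡⟨ trans (∑-const n 1) (*-identityʳ n) ⟩
  n ∎
  where
  open ≤-Reasoning
  covers : ℕ → ℕ → ℕ
  covers x j = 𝟙 (L ∸ j ≤? x)
  at-most-one-cover : ∀ i j j′ → j < j′ → j′ < L → L ∸ j ≤ ℓ (i + j) → ¬ (L ∸ j′ ≤ ℓ (i + j′))
  at-most-one-cover i j j′ j<j′ j′<L covered covered′ = <-irrefl refl (begin-strict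
    ℓ (i + j) ≤⟨ separated (i + j) (j′ ∸ j) (m<n⇒0<n∸m j<j′) j′-j<L later-nonempty ⟩
    j′ ∸ j    <⟨ ∸-monoˡ-< j′<L (<⇒≤ j<j′) ⟩
    L ∸ j     ≤⟨ covered ⟩
    ℓ (i + j) ∎)
    where
    j′-j<L : j′ ∸ j < L
    j′-j<L = ≤-<-trans (m∸n≤m j′ j) j′<L
    later-nonempty : 0 < ℓ (i + j + (j′ ∸ j))
    later-nonempty = subst (λ k → 0 < ℓ k)
      (sym (trans (+-assoc i j _) (cong (_+_ i) (m+[n∸m]≡n (<⇒≤ j<j′)))))
      (<-≤-trans (m<n⇒0<n∸m j′<L) covered′)

toℕ-⊕ : (i : Fin (suc m)) (k : ℕ) → toℕ (i ⊕ k) ≡ (toℕ i + k) % suc m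
toℕ-⊕ i k = toℕ-fromℕ< _

⊕-assoc : (i : Fin (suc m)) (j k : ℕ) → (i ⊕ j) ⊕ k ≡ i ⊕ (j + k)
⊕-assoc {m} i j k = toℕ-injective (begin
  toℕ ((i ⊕ j) ⊕ k)                  ≡⟨ toℕ-⊕ (i ⊕ j) k ⟩
  (toℕ (i ⊕ j) + k) % n              ≡⟨ cong (λ x → (x + k) % n) (toℕ-⊕ i j) ⟩
  ((toℕ i + j) % n + k) % n          ≡⟨ %-distribˡ-+ ((toℕ i + j) % n) k n ⟩
  ((toℕ i + j) % n % n + k % n) % n  ≡⟨ cong (λ x → (x + k % n) % n) (m%n%n≡m%n (toℕ i + j) n) ⟩
  ((toℕ i + j) % n + k % n) % n      ≡⟨ sym (%-distribˡ-+ (toℕ i + j) k n) ⟩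
  (toℕ i + j + k) % n                ≡⟨ cong (_% n) (+-assoc (toℕ i) j k) ⟩
  (toℕ i + (j + k)) % n              ≡⟨ sym (toℕ-⊕ i (j + k)) ⟩
  toℕ (i ⊕ (j + k))                  ∎)
  where
  open ≡-Reasoning
  n = suc m

⊕-identityʳ : (i : Fin (suc m)) → i ⊕ 0 ≡ i
⊕-identityʳ i = toℕ-injective (trans (toℕ-⊕ i 0)
  (trans (cong (_% _) (+-identityʳ (toℕ i))) (m<n⇒m%n≡m (toℕ<n i))))

zero⊕toℕ : (i : Fin (suc m)) → Fin.zero ⊕ toℕ i ≡ i
zero⊕toℕ i = toℕ-injective (trans (toℕ-⊕ Fin.zero (toℕ i)) (m<n⇒m%n≡m (toℕ<n i)))

⊕-periodic : (i : Fin (suc m)) (k : ℕ) → i ⊕ (k + suc m) ≡ i ⊕ k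
⊕-periodic {m} i k = toℕ-injective (begin
  toℕ (i ⊕ (k + suc m))        ≡⟨ toℕ-⊕ i (k + suc m) ⟩
  (toℕ i + (k + suc m)) % suc m ≡⟨ cong (_% suc m) (sym (+-assoc (toℕ i) k (suc m))) ⟩
  (toℕ i + k + suc m) % suc m   ≡⟨ [m+n]%n≡m%n (toℕ i + k) (suc m) ⟩
  (toℕ i + k) % suc m           ≡⟨ sym (toℕ-⊕ i k) ⟩
  toℕ (i ⊕ k)                   ∎)
  where open ≡-Reasoning

⊕-≢ : (i : Fin (suc m)) {d : ℕ} → 0 < d → d < suc m → i ≢ i ⊕ d
⊕-≢ {m} i {d} 0<d d<n i≡i⊕d = not-multiple q (+-cancelˡ-≡ (toℕ i) d (q * suc m) (begin
  toℕ i + d                       ≡⟨ m≡m%n+[m/n]*n (toℕ i + d) (suc m) ⟩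
  (toℕ i + d) % suc m + q * suc m ≡⟨ cong (_+ q * suc m) (sym (trans (cong toℕ i≡i⊕d) (toℕ-⊕ i d))) ⟩
  toℕ i + q * suc m               ∎))
  where
  open ≡-Reasoning
  q = (toℕ i + d) / suc m
  not-multiple : ∀ k → d ≢ k * suc m
  not-multiple zero    d≡0 = <-irrefl (sym d≡0) 0<d
  not-multiple (suc k) d≡n+k*n = <-irrefl refl
    (≤-<-trans (subst (suc m ≤_) (sym d≡n+k*n) (m≤m+n (suc m) (k * suc m))) d<n)

module _ (a : ℕ) {m : ℕ} where

  private
    n = suc m

  within-refl : (v : Fin n) → T (within a v 0 v)
  within-refl v = fromWitness refl

  within-step : ∀ (v : Fin n) k {w u} → T (within a v k w) → T (arc a w u) →
                T (within a v (suc k) u)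
  within-step v k {w} {u} reach-w w→u = Equivalence.from (T-∨ {within a v k u})
    (inj₂ (any⁺ _ (lose (∈-allFin w) (Equivalence.from T-∧ (reach-w , w→u)))))

  arc-step : (w : Fin n) → T (arc a w (w ⊕ 1))
  arc-step w = Equivalence.from (T-∨ {⌊ (w ⊕ 1) ≟F (w ⊕ 1) ⌋}) (inj₁ (fromWitness refl))

  arc-jump : (w : Fin n) → T (arc a w (w ⊕ a))
  arc-jump w = Equivalence.from (T-∨ {⌊ (w ⊕ a) ≟F (w ⊕ 1) ⌋}) (inj₂ (fromWitness refl))

  within-walk : ∀ (v : Fin n) k {w} → T (within a v k w) → ∀ j → T (within a v (j + k) (w ⊕ j))
  within-walk v k {w} reach-w zero    = subst (T ∘ within a v k) (sym (⊕-identityʳ w)) reach-w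
  within-walk v k {w} reach-w (suc j) = subst (T ∘ within a v (suc j + k))
    (trans (⊕-assoc w j 1) (cong (w ⊕_) (+-comm j 1)))
    (within-step v (j + k) (within-walk v k reach-w j) (arc-step (w ⊕ j)))

  minWithin-≤ : ∀ (v u : Fin n) fuel s {k} → s ≤ k → k < s + fuel → T (within a v k u) →
                minWithin a v u fuel s ≤ k
  minWithin-≤ v u zero s s≤k k<s+0 reach =
    contradiction (subst (_ <_) (+-identityʳ s) k<s+0) (≤⇒≯ s≤k)
  minWithin-≤ v u (suc fuel) s {k} s≤k k<s+1+fuel reach with within a v s u in eq
  ... | true  = s≤k
  ... | false = minWithin-≤ v u fuel (suc s) s<k (subst (k <_) (+-suc s fuel) k<s+1+fuel) reach
    where
    s<k : s < k
    s<k = ≤∧≢⇒< s≤k (λ { refl → subst T eq reach })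

  dist-≤ : ∀ (v u : Fin n) {k} → k < n → T (within a v k u) → dist a v u ≤ k
  dist-≤ v u k<n = minWithin-≤ v u n 0 z≤n k<n

  dist-⊕-≤ : ∀ (u : Fin n) {d} → d < n → dist a u (u ⊕ d) ≤ d
  dist-⊕-≤ u {d} d<n = subst (dist a u (u ⊕ d) ≤_) (+-identityʳ d)
    (dist-≤ u (u ⊕ d) (subst (_< n) (sym (+-identityʳ d)) d<n) (within-walk u 0 (within-refl u) d))

  dist-⊕-jump-≤ : ∀ (u : Fin n) {d} → 0 < a → a ≤ d → d < n → dist a u (u ⊕ d) ≤ suc (d ∸ a)
  dist-⊕-jump-≤ u {d} 0<a a≤d d<n = subst (dist a u (u ⊕ d) ≤_) (+-comm (d ∸ a) 1)
    (dist-≤ u (u ⊕ d) level<n (subst (T ∘ within a u (d ∸ a + 1)) landing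
      (within-walk u 1 {u ⊕ a} reach-u⊕a (d ∸ a))))
    where
    reach-u⊕a : T (within a u 1 (u ⊕ a))
    reach-u⊕a = within-step u 0 {u} {u ⊕ a} (within-refl u) (arc-jump u)
    landing : (u ⊕ a) ⊕ (d ∸ a) ≡ u ⊕ d
    landing = trans (⊕-assoc u a (d ∸ a)) (cong (u ⊕_) (m+[n∸m]≡n a≤d))
    level<n : d ∸ a + 1 < n
    level<n = subst (_< n) (+-comm 1 (d ∸ a)) (≤-<-trans (∸-monoʳ-< 0<a a≤d) d<n)

-- Throughout, a = 3 + c, so that a − 1, a − 2 and a − 3 are 2 + c, 1 + c and c.
module _ (c : ℕ) where

  zone : ℕ → ℕ
  zone zero = 0
  zone (suc t) with suc t ≟ 2 + c
  ... | yes _ = 5 + 2 * c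
  ... | no _  = 2 + t

  surcharge : ℕ
  surcharge = (2 + c) * c + (1 + c)

  weight : ℕ → ℕ
  weight t = (2 + c) * t + surcharge * 𝟙 (t ≟ 2 + c)

  zone-≤-max : ∀ t → t ≤ 2 + c → zone t ≤ 5 + 2 * c
  zone-≤-max zero    _   = z≤n
  zone-≤-max (suc t) t≤a-1 with suc t ≟ 2 + c
  ... | yes _ = ≤-refl
  ... | no _  = ≤-trans (s≤s t≤a-1) (+-monoʳ-≤ 3 (≤-trans (m≤m+n c (c + 0)) (m≤n+m (2 * c) 2)))

  zone-pos : ∀ t → 0 < zone t → 0 < t
  zone-pos (suc t) _ = s≤s z≤n

  zone-≤-offset : ∀ t δ d → (0 < t → t < δ) → δ ≤ d → (3 + c ≤ d → δ ≤ suc (d ∸ (3 + c))) →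
                  d < 5 + 2 * c → zone t ≤ d
  zone-≤-offset zero    δ d t<δ δ≤d δ≤jump d<2a-1 = z≤n
  zone-≤-offset (suc t) δ d t<δ δ≤d δ≤jump d<2a-1 with suc t ≟ 2 + c
  ... | no _      = <-≤-trans (t<δ (s≤s z≤n)) δ≤d
  ... | yes t≡a-1 = contradiction (<-≤-trans (t<δ (s≤s z≤n)) δ≤a-1) (<-irrefl t≡a-1)
    where
    d∸a≤1+c : d ∸ (3 + c) ≤ 1 + c
    d∸a≤1+c = subst (d ∸ (3 + c) ≤_) (m+n∸m≡n (3 + c) (1 + c))
      (∸-monoˡ-≤ (3 + c) (subst (d ≤_) (2a-2≡ c) (≤-pred d<2a-1)))
      where
      2a-2≡ : ∀ c → 4 + 2 * c ≡ (3 + c) + (1 + c)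
      2a-2≡ = solve-∀
    δ≤a-1 : δ ≤ 2 + c
    δ≤a-1 with 3 + c ≤? d
    ... | yes a≤d = ≤-trans (δ≤jump a≤d) (s≤s d∸a≤1+c)
    ... | no  a≰d = ≤-trans δ≤d (≤-pred (≰⇒> a≰d))

  weight-≤ : ∀ t → t ≤ 2 + c → weight t ≤ (1 + c) * zone t
  weight-≤ zero    _ = ≤-reflexive
    (trans (cong₂ _+_ (*-zeroʳ (2 + c)) (*-zeroʳ surcharge)) (sym (*-zeroʳ (1 + c))))
  weight-≤ (suc t) t≤a-1 with suc t ≟ 2 + c
  ... | yes refl = ≤-reflexive (top c)
    where
    top : ∀ c → (2 + c) * (2 + c) + ((2 + c) * c + (1 + c)) * 1 ≡ (1 + c) * (5 + 2 * c)
    top = solve-∀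
  ... | no t≢a-1 = begin
    (2 + c) * suc t + surcharge * 0                  ≡⟨ split c t ⟩
    (1 + c) * suc t + suc t                          ≤⟨ +-monoʳ-≤ ((1 + c) * suc t) t<a-1 ⟩
    (1 + c) * suc t + (1 + c)                        ≡⟨ merge c t ⟩
    (1 + c) * (2 + t)                                ∎
    where
    open ≤-Reasoning
    t<a-1 : suc t ≤ 1 + c
    t<a-1 = ≤-pred (≤∧≢⇒< t≤a-1 t≢a-1)
    split : ∀ c t → (2 + c) * suc t + ((2 + c) * c + (1 + c)) * 0 ≡ (1 + c) * suc t + suc t
    split = solve-∀
    merge : ∀ c t → (1 + c) * suc t + (1 + c) ≡ (1 + c) * (2 + t)
    merge = solve-∀

  module _ {m : ℕ} (f : Fin (suc m) → ℕ) (ib : IndependentBroadcast (suc m) (3 + c) f)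
           (bounded : Bounded (2 + c) f) (2a≤n : 6 + 2 * c ≤ suc m) where

    private
      n = suc m
      a = 3 + c

      g : ℕ → ℕ
      g i = f (Fin.zero ⊕ i)

      g-periodic : ∀ i → g (i + n) ≡ g i
      g-periodic i = cong f (⊕-periodic Fin.zero i)

      cost≡∑ : cost f ≡ ∑ n g
      cost≡∑ = sum-map-allFin f g (cong f ∘ zero⊕toℕ)

      countEq≡∑ : countEq (2 + c) f ≡ ∑[ i < n ] 𝟙 (g i ≟ 2 + c)
      countEq≡∑ = trans (length-filter≡sum-𝟙 (λ v → f v ≟ 2 + c) (allFin n))
        (sum-map-allFin (λ v → 𝟙 (f v ≟ 2 + c)) (λ i → 𝟙 (g i ≟ 2 + c))
          (λ v → cong (λ x → 𝟙 (x ≟ 2 + c)) (cong f (zero⊕toℕ v))))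

      strength<dist : ∀ p d → 0 < d → d < n → 0 < g p → 0 < g (p + d) →
                      g p < dist a (Fin.zero ⊕ p) ((Fin.zero ⊕ p) ⊕ d)
      strength<dist p d 0<d d<n near far =
        subst (λ w → g p < dist a u w) (sym (⊕-assoc Fin.zero p d))
          (proj₂ (proj₂ ib) u (Fin.zero ⊕ (p + d)) u≢ near far)
        where
        u = Fin.zero ⊕ p
        u≢ : u ≢ Fin.zero ⊕ (p + d)
        u≢ u≡ = ⊕-≢ u 0<d d<n (trans u≡ (sym (⊕-assoc Fin.zero p d)))

      zone-separated : ∀ p d → 0 < d → d < 5 + 2 * c → 0 < zone (g (p + d)) → zone (g p) ≤ d
      zone-separated p d 0<d d<2a-1 far = zone-≤-offset (g p) (dist a u (u ⊕ d)) d
        (λ near → strength<dist p d 0<d d<n near (zone-pos (g (p + d)) far))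
        (dist-⊕-≤ a u d<n) (λ a≤d → dist-⊕-jump-≤ a u (s≤s z≤n) a≤d d<n) d<2a-1
        where
        u = Fin.zero ⊕ p
        d<n : d < n
        d<n = <-≤-trans (<-trans d<2a-1 (n<1+n _)) 2a≤n

      ∑zone≤n : ∑[ i < n ] zone (g i) ≤ n
      ∑zone≤n = disjoint-intervals⇒∑≤period n (5 + 2 * c) (zone ∘ g) (cong zone ∘ g-periodic)
        (λ i → zone-≤-max (g i) (bounded _)) zone-separated

    weighted-cost-≤ : (2 + c) * cost f + surcharge * countEq (2 + c) f ≤ (1 + c) * n
    weighted-cost-≤ = begin
      (2 + c) * cost f + surcharge * countEq (2 + c) f
        ≡⟨ cong₂ (λ x y → (2 + c) * x + surcharge * y) cost≡∑ countEq≡∑ ⟩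
      (2 + c) * ∑ n g + surcharge * ∑[ i < n ] 𝟙 (g i ≟ 2 + c)
        ≡⟨ sym (cong₂ _+_ (∑-distribˡ-* n (2 + c) g) (∑-distribˡ-* n surcharge (𝟙 ∘ (_≟ 2 + c) ∘ g))) ⟩
      ∑[ i < n ] ((2 + c) * g i) + ∑[ i < n ] (surcharge * 𝟙 (g i ≟ 2 + c))
        ≡⟨ sym (∑-distrib-+ n (λ i → (2 + c) * g i) (λ i → surcharge * 𝟙 (g i ≟ 2 + c))) ⟩
      ∑[ i < n ] weight (g i)
        ≤⟨ ∑-mono-≤ n (λ i → weight-≤ (g i) (bounded _)) ⟩
      ∑[ i < n ] ((1 + c) * zone (g i))
        ≡⟨ ∑-distribˡ-* n (1 + c) (zone ∘ g) ⟩
      (1 + c) * ∑[ i < n ] zone (g i)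
        ≤⟨ *-monoʳ-≤ (1 + c) ∑zone≤n ⟩
      (1 + c) * n ∎
      where open ≤-Reasoning

  floor-bound : ∀ σ k n → (2 + c) * σ + surcharge * k ≤ (1 + c) * n →
                σ + c * k ≤ (1 + c) * (n ∸ k) / (2 + c)
  floor-bound σ k n weighted≤ = begin
    σ + c * k                       ≡⟨ sym (m*n/n≡m (σ + c * k) (2 + c)) ⟩
    (σ + c * k) * (2 + c) / (2 + c) ≤⟨ /-monoˡ-≤ (2 + c) scaled≤ ⟩
    (1 + c) * (n ∸ k) / (2 + c)     ∎
    where
    open ≤-Reasoning
    regroup : ∀ c σ k → (2 + c) * σ + ((2 + c) * c + (1 + c)) * k ≡ (σ + c * k) * (2 + c) + (1 + c) * k
    regroup = solve-∀
    scaled≤ : (σ + c * k) * (2 + c) ≤ (1 + c) * (n ∸ k)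
    scaled≤ = subst ((σ + c * k) * (2 + c) ≤_) (sym (*-distribˡ-∸ (1 + c) n k))
      (m+n≤o⇒m≤o∸n _ (subst (_≤ (1 + c) * n) (regroup c σ k) weighted≤))

m+n≤o⇒+m≤+o-+n : ∀ {x y z} → x + y ≤ z → + x ≤ℤ + z - + y
m+n≤o⇒+m≤+o-+n {x} {y} {z} x+y≤z = subst (+ x ≤ℤ_) (sym (trans (m-n≡m⊖n z y) (⊖-≥ y≤z)))
  (+≤+ (m+n≤o⇒m≤o∸n x x+y≤z))
  where
  y≤z : y ≤ z
  y≤z = ≤-trans (m≤n+m y x) x+y≤z

independent-broadcast-cost-≤ : ∀ n a → 3 ≤ a → 2 * a ≤ n →
  (f : Fin n → ℕ) → IndependentBroadcast n a f → Bounded (a ∸ 1) f →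
  + cost f ≤ℤ (+ fdiv ((a ∸ 2) * (n ∸ countEq (a ∸ 1) f)) (a ∸ 1))
              - (+ ((a ∸ 3) * countEq (a ∸ 1) f))
independent-broadcast-cost-≤ zero    (suc (suc (suc c))) _ ()
independent-broadcast-cost-≤ (suc m) (suc (suc (suc c))) (s≤s (s≤s (s≤s z≤n))) 2a≤n f ib bounded =
  m+n≤o⇒+m≤+o-+n (floor-bound c (cost f) (countEq (2 + c) f) (suc m)
    (weighted-cost-≤ c f ib bounded (subst (_≤ suc m) (2a≡ c) 2a≤n)))
  where
  2a≡ : ∀ c → 2 * (3 + c) ≡ 6 + 2 * c
  2a≡ = solve-∀

proposition17 : (n a q r : ℕ) → n ≡ q * a + r → 4 ≤ a → 2 ≤ q →
    ((a ≤ q + r + 1 × r ≤ a ∸ 2) ⊎ (a ≤ q + 1 × r ≡ a ∸ 1)) →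
    (f : Fin n → ℕ) → IndependentBroadcast n a f → Bounded (a ∸ 1) f →
    + cost f ≤ℤ (+ fdiv ((a ∸ 2) * (n ∸ countEq (a ∸ 1) f)) (a ∸ 1))
                  - (+ ((a ∸ 3) * countEq (a ∸ 1) f))
proposition17 n a q r n≡qa+r 4≤a 2≤q _ =
  independent-broadcast-cost-≤ n a (≤-trans (n≤1+n 3) 4≤a) 2a≤n
  where
  2a≤n : 2 * a ≤ n
  2a≤n = subst (2 * a ≤_) (sym n≡qa+r) (≤-trans (*-monoˡ-≤ a 2≤q) (m≤m+n (q * a) r))
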